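{- Let $G$ be a connected threshold graph on $n$ vertices with binary sequence $\mathbf{b}=(b_1,\ldots,b_n)$, and let $l_1\in\{1,\ldots,n-1\}$ be such that $b_{l_1+1}=\cdots=b_n$ and $b_{l_1}\neq b_{l_1+1}$. Then the Laplacian eigenspace $\mathcal{E}_L(n)$ of $G$ is simply structured if and only if $1\leq l_1\leq \lfloor n/2\rfloor$.
   Context: Threshold graph: given a sequence $\mathbf{b}=(b_1,\ldots,b_n)$ of 0's and 1's with $b_1=0$, the associated threshold graph has vertices $1,\ldots,n$ added in order; when vertex $i$ is added, it is isolated if $b_i=0$, and it is joined to all vertices $j<i$ if $b_i=1$. The graph is connected iff $b_n=1$. The Laplacian matrix is $L(G)=D(G)-A(G)$ (degree matrix minus adjacency matrix); for an eigenvalue $\mu$ of $L(G)$, $\mathcal{E}_L(\mu)$ denotes the corresponding eigenspace. An eigenspace is simply structured if it admits a basis consisting of vectors whose entries all lie in $\{ -1,0,1\}$.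
   Formalization: The Laplacian eigenspace $\mathcal{E}_L(n)$ is taken over ℚ, with rational vectors and rational coefficients for linear independence and spanning. -}

module Defs where

open import Data.Nat using (ℕ; zero; suc; _<ᵇ_)
open import Data.Bool using (Bool; true; false; if_then_else_; _∧_; _∨_)
open import Data.Fin using (Fin; toℕ; _≟_)
import Data.Fin as F
open import Data.Integer using (+_)
open import Data.Rational using (ℚ; 0ℚ; 1ℚ; -_; _+_; _-_; _*_; _/_)
open import Data.Product using (Σ; _×_)
open import Data.Sum using (_⊎_)
open import Relation.Binary.PropositionalEquality using (_≡_)
open import Relation.Nullary.Decidable using (⌊_⌋)

sumℚ : {n : ℕ} → (Fin n → ℚ) → ℚ
sumℚ {zero}  f = 0ℚ
sumℚ {suc n} f = f F.zero + sumℚ (λ i → f (F.suc i))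

ℕtoℚ : ℕ → ℚ
ℕtoℚ n = + n / 1

-- Threshold graph of a binary sequence b (vertex i ↦ index i-1 in Fin n).
-- Vertex j is joined to every earlier vertex i < j iff b j = true.
-- adj b i j = true iff i and j are adjacent.
adj : {n : ℕ} → (Fin n → Bool) → Fin n → Fin n → Bool
adj b i j = ((toℕ i <ᵇ toℕ j) ∧ b j) ∨ ((toℕ j <ᵇ toℕ i) ∧ b i)

adjℚ : {n : ℕ} → (Fin n → Bool) → Fin n → Fin n → ℚ
adjℚ b i j = if adj b i j then 1ℚ else 0ℚ

degree : {n : ℕ} → (Fin n → Bool) → Fin n → ℚ
degree b i = sumℚ (adjℚ b i)

laplacian : {n : ℕ} → (Fin n → Bool) → Fin n → Fin n → ℚ
laplacian b i j = (if ⌊ i ≟ j ⌋ then degree b i else 0ℚ) - adjℚ b i j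

mulVec : {n : ℕ} → (Fin n → Fin n → ℚ) → (Fin n → ℚ) → Fin n → ℚ
mulVec M x i = sumℚ (λ j → M i j * x j)

InEigenspace : {n : ℕ} → (Fin n → Fin n → ℚ) → ℚ → (Fin n → ℚ) → Set
InEigenspace M μ x = ∀ i → mulVec M x i ≡ μ * x i

linComb : {n k : ℕ} → (Fin k → ℚ) → (Fin k → Fin n → ℚ) → Fin n → ℚ
linComb c v i = sumℚ (λ t → c t * v t i)

LinearlyIndependent : {n k : ℕ} → (Fin k → Fin n → ℚ) → Set
LinearlyIndependent v = ∀ c → (∀ i → linComb c v i ≡ 0ℚ) → ∀ t → c t ≡ 0ℚ

IsEigenbasis : {n k : ℕ} → (Fin n → Fin n → ℚ) → ℚ → (Fin k → Fin n → ℚ) → Set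
IsEigenbasis M μ v =
  (∀ t → InEigenspace M μ (v t)) ×
  LinearlyIndependent v ×
  (∀ x → InEigenspace M μ x → Σ _ λ c → ∀ i → x i ≡ linComb c v i)

IsTernary : ℚ → Set
IsTernary q = (q ≡ - 1ℚ) ⊎ (q ≡ 0ℚ) ⊎ (q ≡ 1ℚ)

SimplyStructured : {n : ℕ} → (Fin n → Fin n → ℚ) → ℚ → Set
SimplyStructured {n} M μ =
  Σ ℕ λ k → Σ (Fin k → Fin n → ℚ) λ v →
    IsEigenbasis M μ v × (∀ t i → IsTernary (v t i))

{-# OPTIONS --safe #-}
module Submission where

-- Write J for the all-ones matrix and Ḡ for the complement of G. Then L(G) + L(Ḡ) + J = nI, so
-- x ∈ E_L(n) iff Σx + (L(Ḡ)x)ᵢ = 0 at every vertex i. Number the vertices from 0. The vertices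
-- from l₁ on are dominating in G, hence isolated in Ḡ; their rows give Σx = 0, and then L(Ḡ)x = 0.
-- The block {0, …, l₁ − 1} is connected in Ḡ, because its last vertex p = l₁ − 1 is adjacent in
-- G to none of the others; a maximum of x on the block therefore spreads along the edges of Ḡ,
-- and x is constant on the block. So E_L(n) = {x | Σx = 0 and x is constant on the block}.
--
-- If 2l₁ ≤ n, this space has the {−1,0,1}-basis consisting of the vector that is 1 on the block
-- and −1 on the next l₁ vertices, together with eᵢ − e_{l₁} for l₁ < i < n. Conversely, E_L(n)
-- contains a vector that is nonzero at p (1 on the block, −l₁ at vertex l₁), so every basis has
-- a member that is nonzero at p. If that member is {−1,0,1}-valued then, up to sign, it is 1 on
-- the l₁ block vertices and at least −1 elsewhere, and Σ = 0 forces l₁ ≤ n − l₁.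

open import Defs
open import Data.Nat using (ℕ; suc; _≤_; _∸_; _/_)
open import Data.Bool using (Bool; true; false)
open import Data.Fin using (Fin; toℕ)
open import Data.Product using (_×_)
open import Relation.Binary.PropositionalEquality using (_≡_; _≢_)
open import Function.Bundles using (_⇔_)

open import Algebra.Bundles using (Ring)
import Algebra.Properties.Ring as RingProperties
import Algebra.Properties.Semiring.Sum as SemiringSum
open import Data.Bool using (if_then_else_; not)
open import Data.Bool.Properties using (∨-identityʳ; ¬-not)
open import Data.Fin using (zero; suc; punchIn)
import Data.Fin as Fin
import Data.Fin.Properties as Fin
import Data.Integer as ℤ
import Data.Integer.Properties as ℤ
import Data.Integer.Tactic.RingSolver as ℤ
open import Data.List using (List; allFin; filter)
open import Data.List.Membership.Propositional.Properties using (∈-filter⁺; ∈-allFin)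
import Data.List.Relation.Unary.All as All
open import Data.List.Relation.Unary.All.Properties using (all-filter)
open import Data.Nat using (zero; _<_; _<ᵇ_; _≡ᵇ_; _<?_; s≤s)
import Data.Nat as ℕ
import Data.Nat.Coprimality as Coprime
open import Data.Nat.DivMod using (m/n*n≤m; m*n/n≡m; /-monoˡ-≤)
import Data.Nat.Properties as ℕ
open import Data.Product using (Σ-syntax; _,_; proj₁; proj₂)
open import Data.Rational using (ℚ; mkℚ; 0ℚ; 1ℚ; -_; _+_; _*_; _-_)
import Data.Rational as ℚ
import Data.Rational.Properties as ℚ
open import Data.Rational.Unnormalised.Base using (*≡*)
import Data.Rational.Unnormalised.Properties as ℚᵘ
open import Data.Sum using (_⊎_; inj₁; inj₂; [_,_])
open import Function.Base using (_∘_)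
open import Function.Bundles using (mk⇔; Equivalence)
open import Level using (0ℓ)
open import Relation.Binary.Bundles using (DecTotalOrder)
open import Relation.Binary.Definitions using (tri<; tri≈; tri>)
open import Relation.Binary.PropositionalEquality
  using (refl; sym; trans; cong; cong₂; subst; _≗_; module ≡-Reasoning)
open import Relation.Nullary using (contradiction; yes; no)
open import Relation.Nullary.Decidable using (⌊_⌋; isYes≗does; dec-true; dec-false; dec⇒maybe)
open import Relation.Unary using (Pred; Decidable)
open import Tactic.RingSolver using (solve-∀)
open import Tactic.RingSolver.Core.AlmostCommutativeRing using (AlmostCommutativeRing; fromCommutativeRing)
open import Data.List.Extrema (DecTotalOrder.totalOrder ℚ.≤-decTotalOrder)
  using (argmax; argmax-all; f[xs]≤f[argmax])

private
  module ℚ-ring = RingProperties ℚ.+-*-ring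
  module ℚ-sum = SemiringSum (Ring.semiring ℚ.+-*-ring)

  ℚ-solverRing : AlmostCommutativeRing _ _
  ℚ-solverRing = fromCommutativeRing ℚ.+-*-commutativeRing (λ q → dec⇒maybe (0ℚ ℚ.≟ q))

open ℚ-sum using (sum)

private variable n k : ℕ

sumℚ≡sum : (f : Fin n → ℚ) → sumℚ f ≡ sum f
sumℚ≡sum {zero}  f = refl
sumℚ≡sum {suc n} f = cong (f zero +_) (sumℚ≡sum (f ∘ suc))

sumℚ-cong : {f g : Fin n → ℚ} → f ≗ g → sumℚ f ≡ sumℚ g
sumℚ-cong {f = f} {g} f≗g rewrite sumℚ≡sum f | sumℚ≡sum g = ℚ-sum.sum-cong-≗ f≗g

sumℚ-distrib-+ : (f g : Fin n → ℚ) → sumℚ (λ i → f i + g i) ≡ sumℚ f + sumℚ g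
sumℚ-distrib-+ f g rewrite sumℚ≡sum f | sumℚ≡sum g | sumℚ≡sum (λ i → f i + g i) = ℚ-sum.∑-distrib-+ f g

*-distribˡ-sumℚ : (c : ℚ) (f : Fin n → ℚ) → c * sumℚ f ≡ sumℚ (λ i → c * f i)
*-distribˡ-sumℚ c f rewrite sumℚ≡sum f | sumℚ≡sum (λ i → c * f i) = ℚ-sum.*-distribˡ-sum c f

*-distribʳ-sumℚ : (c : ℚ) (f : Fin n → ℚ) → sumℚ f * c ≡ sumℚ (λ i → f i * c)
*-distribʳ-sumℚ c f rewrite sumℚ≡sum f | sumℚ≡sum (λ i → f i * c) = ℚ-sum.*-distribʳ-sum c f

sumℚ-distrib-neg : (f : Fin n → ℚ) → sumℚ (λ i → - f i) ≡ - sumℚ f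
sumℚ-distrib-neg f = begin
  sumℚ (λ i → - f i)         ≡⟨ sumℚ-cong (λ i → sym (ℚ-ring.-1*x≈-x (f i))) ⟩
  sumℚ (λ i → - 1ℚ * f i)    ≡⟨ sym (*-distribˡ-sumℚ (- 1ℚ) f) ⟩
  - 1ℚ * sumℚ f              ≡⟨ ℚ-ring.-1*x≈-x (sumℚ f) ⟩
  - sumℚ f                   ∎
  where open ≡-Reasoning

sumℚ-distrib-minus : (f g : Fin n → ℚ) → sumℚ (λ i → f i - g i) ≡ sumℚ f - sumℚ g
sumℚ-distrib-minus f g = trans (sumℚ-distrib-+ f (λ i → - g i)) (cong (sumℚ f +_) (sumℚ-distrib-neg g))

sumℚ-zero : (f : Fin n → ℚ) → (∀ i → f i ≡ 0ℚ) → sumℚ f ≡ 0ℚ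
sumℚ-zero {n} f f≗0 = trans (sumℚ-cong f≗0) (trans (sumℚ≡sum {n} (λ _ → 0ℚ)) (ℚ-sum.sum-replicate-zero n))

sumℚ-comm : (f : Fin n → Fin k → ℚ) →
            sumℚ (λ i → sumℚ (f i)) ≡ sumℚ (λ t → sumℚ (λ i → f i t))
sumℚ-comm {n} {k} f = begin
  sumℚ (λ i → sumℚ (f i))            ≡⟨ sumℚ-cong {n} (λ i → sumℚ≡sum (f i)) ⟩
  sumℚ (λ i → sum (f i))             ≡⟨ sumℚ≡sum {n} _ ⟩
  sum (λ i → sum (f i))              ≡⟨ ℚ-sum.∑-comm f ⟩
  sum (λ t → sum (λ i → f i t))      ≡⟨ sym (sumℚ≡sum {k} _) ⟩
  sumℚ (λ t → sum (λ i → f i t))     ≡⟨ sumℚ-cong {k} (λ t → sym (sumℚ≡sum (λ i → f i t))) ⟩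
  sumℚ (λ t → sumℚ (λ i → f i t))    ∎
  where open ≡-Reasoning

sumℚ-supported : (q : Fin n) (f : Fin n → ℚ) → (∀ i → i ≢ q → f i ≡ 0ℚ) → sumℚ f ≡ f q
sumℚ-supported {suc n} q f off-q = begin
  sumℚ f                              ≡⟨ sumℚ≡sum f ⟩
  sum f                               ≡⟨ ℚ-sum.sum-remove f ⟩
  f q + sum (f ∘ punchIn q)           ≡⟨ cong (f q +_) (trans (sym (sumℚ≡sum (f ∘ punchIn q))) punched-out) ⟩
  f q + 0ℚ                            ≡⟨ ℚ.+-identityʳ (f q) ⟩
  f q                                 ∎
  where
  open ≡-Reasoning
  punched-out : sumℚ (f ∘ punchIn q) ≡ 0ℚ
  punched-out = sumℚ-zero _ (λ j → off-q _ (Fin.punchInᵢ≢i q j))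

nonneg-+-zeroˡ : {x y : ℚ} → 0ℚ ℚ.≤ x → 0ℚ ℚ.≤ y → x + y ≡ 0ℚ → x ≡ 0ℚ
nonneg-+-zeroˡ {x} {y} 0≤x 0≤y x+y≡0 = ℚ.≤-antisym x≤0 0≤x
  where
  open ℚ.≤-Reasoning
  x≤0 : x ℚ.≤ 0ℚ
  x≤0 = begin
    x       ≡⟨ sym (ℚ.+-identityʳ x) ⟩
    x + 0ℚ  ≤⟨ ℚ.+-monoʳ-≤ x 0≤y ⟩
    x + y   ≡⟨ x+y≡0 ⟩
    0ℚ      ∎

nonneg-+-zeroʳ : {x y : ℚ} → 0ℚ ℚ.≤ x → 0ℚ ℚ.≤ y → x + y ≡ 0ℚ → y ≡ 0ℚ
nonneg-+-zeroʳ {x} {y} 0≤x 0≤y x+y≡0 = nonneg-+-zeroˡ 0≤y 0≤x (trans (ℚ.+-comm y x) x+y≡0)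

sumℚ-mono-≤ : {f g : Fin n → ℚ} → (∀ i → f i ℚ.≤ g i) → sumℚ f ℚ.≤ sumℚ g
sumℚ-mono-≤ {zero}  f≤g = ℚ.≤-refl
sumℚ-mono-≤ {suc n} f≤g = ℚ.+-mono-≤ (f≤g zero) (sumℚ-mono-≤ (f≤g ∘ suc))

sumℚ-nonneg : {f : Fin n → ℚ} → (∀ i → 0ℚ ℚ.≤ f i) → 0ℚ ℚ.≤ sumℚ f
sumℚ-nonneg {zero}  0≤f = ℚ.≤-refl
sumℚ-nonneg {suc n} 0≤f = ℚ.+-mono-≤ (0≤f zero) (sumℚ-nonneg (0≤f ∘ suc))

nonneg-sumℚ-zero : {f : Fin n → ℚ} → (∀ i → 0ℚ ℚ.≤ f i) → sumℚ f ≡ 0ℚ → ∀ i → f i ≡ 0ℚ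
nonneg-sumℚ-zero {suc n} 0≤f Σf≡0 zero =
  nonneg-+-zeroˡ (0≤f zero) (sumℚ-nonneg (0≤f ∘ suc)) Σf≡0
nonneg-sumℚ-zero {suc n} 0≤f Σf≡0 (suc i) =
  nonneg-sumℚ-zero (0≤f ∘ suc) (nonneg-+-zeroʳ (0≤f zero) (sumℚ-nonneg (0≤f ∘ suc)) Σf≡0) i

*-nonneg : {a c : ℚ} → 0ℚ ℚ.≤ a → 0ℚ ℚ.≤ c → 0ℚ ℚ.≤ a * c
*-nonneg {a} {c} 0≤a 0≤c =
  ℚ.nonNegative⁻¹ (a * c) {{ℚ.nonNeg*nonNeg⇒nonNeg a {{ℚ.nonNegative 0≤a}} c {{ℚ.nonNegative 0≤c}}}}

≤⇒0≤- : {a c : ℚ} → a ℚ.≤ c → 0ℚ ℚ.≤ c - a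
≤⇒0≤- {a} {c} a≤c = subst (ℚ._≤ c - a) (ℚ.+-inverseʳ a) (ℚ.+-monoˡ-≤ (- a) a≤c)

ℕtoℚ≡mkℚ : ∀ m → ℕtoℚ m ≡ mkℚ (ℤ.+ m) 0 (Coprime.sym (Coprime.1-coprimeTo m))
ℕtoℚ≡mkℚ m = ℚ.normalize-coprime _

ℕtoℚ-suc : ∀ m → ℕtoℚ (suc m) ≡ 1ℚ + ℕtoℚ m
ℕtoℚ-suc m rewrite ℕtoℚ≡mkℚ m | ℕtoℚ≡mkℚ (suc m) =
  ℚ.toℚᵘ-injective (ℚᵘ.≃-trans (*≡* (cross-multiplied (ℤ.+ m))) (ℚᵘ.≃-sym (ℚ.toℚᵘ-homo-+ 1ℚ m/1)))
  where
  m/1 : ℚ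
  m/1 = mkℚ (ℤ.+ m) 0 (Coprime.sym (Coprime.1-coprimeTo m))
  cross-multiplied : ∀ z → (ℤ.+ 1 ℤ.+ z) ℤ.* ℤ.+ 1 ≡ (ℤ.+ 1 ℤ.* ℤ.+ 1 ℤ.+ z ℤ.* ℤ.+ 1) ℤ.* ℤ.+ 1
  cross-multiplied = ℤ.solve-∀

ℕtoℚ-+ : ∀ a b → ℕtoℚ (a ℕ.+ b) ≡ ℕtoℚ a + ℕtoℚ b
ℕtoℚ-+ zero    b = sym (ℚ.+-identityˡ (ℕtoℚ b))
ℕtoℚ-+ (suc a) b = begin
  ℕtoℚ (suc (a ℕ.+ b))         ≡⟨ ℕtoℚ-suc (a ℕ.+ b) ⟩
  1ℚ + ℕtoℚ (a ℕ.+ b)          ≡⟨ cong (1ℚ +_) (ℕtoℚ-+ a b) ⟩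
  1ℚ + (ℕtoℚ a + ℕtoℚ b)       ≡⟨ sym (ℚ.+-assoc 1ℚ (ℕtoℚ a) (ℕtoℚ b)) ⟩
  (1ℚ + ℕtoℚ a) + ℕtoℚ b       ≡⟨ cong (_+ ℕtoℚ b) (sym (ℕtoℚ-suc a)) ⟩
  ℕtoℚ (suc a) + ℕtoℚ b        ∎
  where open ≡-Reasoning

ℕtoℚ-cancel-≤ : ∀ {a b} → ℕtoℚ a ℚ.≤ ℕtoℚ b → a ≤ b
ℕtoℚ-cancel-≤ {a} {b} a≤b rewrite ℕtoℚ≡mkℚ a | ℕtoℚ≡mkℚ b
  with ℚ.drop-*≤* a≤b
... | a*1≤b*1 rewrite ℤ.*-identityʳ (ℤ.+ a) | ℤ.*-identityʳ (ℤ.+ b) = ℤ.drop‿+≤+ a*1≤b*1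

sumℚ-const : ∀ n (c : ℚ) → sumℚ {n} (λ _ → c) ≡ ℕtoℚ n * c
sumℚ-const zero    c = sym (ℚ.*-zeroˡ c)
sumℚ-const (suc n) c = begin
  c + sumℚ {n} (λ _ → c)   ≡⟨ cong (c +_) (sumℚ-const n c) ⟩
  c + ℕtoℚ n * c           ≡⟨ cong (_+ ℕtoℚ n * c) (sym (ℚ.*-identityˡ c)) ⟩
  1ℚ * c + ℕtoℚ n * c      ≡⟨ sym (ℚ.*-distribʳ-+ c 1ℚ (ℕtoℚ n)) ⟩
  (1ℚ + ℕtoℚ n) * c        ≡⟨ cong (_* c) (sym (ℕtoℚ-suc n)) ⟩
  ℕtoℚ (suc n) * c         ∎
  where open ≡-Reasoning

u-s+s≡u : ∀ u s → (u - s) + s ≡ u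
u-s+s≡u = solve-∀ ℚ-solverRing

<ᵇ-true : ∀ {a c} → a < c → (a <ᵇ c) ≡ true
<ᵇ-true {a} {c} = dec-true (a <? c)

<ᵇ-false : ∀ {a c} → c ≤ a → (a <ᵇ c) ≡ false
<ᵇ-false {a} {c} c≤a = dec-false (a <? c) (ℕ.≤⇒≯ c≤a)

≡ᵇ-true : ∀ {a c} → a ≡ c → (a ≡ᵇ c) ≡ true
≡ᵇ-true {a} {c} = dec-true (a ℕ.≟ c)

≡ᵇ-false : ∀ {a c} → a ≢ c → (a ≡ᵇ c) ≡ false
≡ᵇ-false {a} {c} = dec-false (a ℕ.≟ c)

𝟙[<_] : ℕ → Fin n → ℚ
𝟙[< a ] i = if toℕ i <ᵇ a then 1ℚ else 0ℚ

𝟙[≡_] : ℕ → Fin n → ℚ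
𝟙[≡ a ] i = if toℕ i ≡ᵇ a then 1ℚ else 0ℚ

𝟙[<]-in : ∀ {a} (i : Fin n) → toℕ i < a → 𝟙[< a ] i ≡ 1ℚ
𝟙[<]-in i i<a rewrite <ᵇ-true i<a = refl

𝟙[<]-out : ∀ {a} (i : Fin n) → a ≤ toℕ i → 𝟙[< a ] i ≡ 0ℚ
𝟙[<]-out i a≤i rewrite <ᵇ-false a≤i = refl

𝟙[≡]-at : ∀ {a} (i : Fin n) → toℕ i ≡ a → 𝟙[≡ a ] i ≡ 1ℚ
𝟙[≡]-at i i≡a rewrite ≡ᵇ-true i≡a = refl

𝟙[≡]-off : ∀ {a} (i : Fin n) → toℕ i ≢ a → 𝟙[≡ a ] i ≡ 0ℚ
𝟙[≡]-off i i≢a rewrite ≡ᵇ-false i≢a = refl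

sumℚ-𝟙[<] : ∀ n a → a ≤ n → sumℚ {n} 𝟙[< a ] ≡ ℕtoℚ a
sumℚ-𝟙[<] zero    zero    _         = refl
sumℚ-𝟙[<] (suc n) zero    _         = trans (ℚ.+-identityˡ _) (sumℚ-zero {n} _ (λ _ → refl))
sumℚ-𝟙[<] (suc n) (suc a) (s≤s a≤n) = trans (cong (1ℚ +_) (sumℚ-𝟙[<] n a a≤n)) (sym (ℕtoℚ-suc a))

sumℚ-𝟙[≡] : ∀ n a → a < n → sumℚ {n} 𝟙[≡ a ] ≡ 1ℚ
sumℚ-𝟙[≡] (suc n) zero    _         = trans (cong (1ℚ +_) (sumℚ-zero {n} _ (λ _ → refl))) (ℚ.+-identityʳ 1ℚ)
sumℚ-𝟙[≡] (suc n) (suc a) (s≤s a<n) = trans (ℚ.+-identityˡ _) (sumℚ-𝟙[≡] n a a<n)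

ternary-neg : ∀ {q} → IsTernary q → IsTernary (- q)
ternary-neg (inj₁ refl)        = inj₂ (inj₂ refl)
ternary-neg (inj₂ (inj₁ refl)) = inj₂ (inj₁ refl)
ternary-neg (inj₂ (inj₂ refl)) = inj₁ refl

ternary⇒≥-1 : ∀ {q} → IsTernary q → - 1ℚ ℚ.≤ q
ternary⇒≥-1 (inj₁ refl)        = ℚ.≤-refl
ternary⇒≥-1 (inj₂ (inj₁ refl)) = ℚ.*≤* ℤ.-≤+
ternary⇒≥-1 (inj₂ (inj₂ refl)) = ℚ.*≤* ℤ.-≤+

ternary-0/1-difference : ∀ c c′ → IsTernary ((if c then 1ℚ else 0ℚ) - (if c′ then 1ℚ else 0ℚ))
ternary-0/1-difference true  true  = inj₂ (inj₁ refl)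
ternary-0/1-difference true  false = inj₂ (inj₂ refl)
ternary-0/1-difference false true  = inj₁ refl
ternary-0/1-difference false false = inj₂ (inj₁ refl)

ternary-sum-bound : ∀ {l} (f : Fin n → ℚ) → l ≤ n → (∀ i → IsTernary (f i)) →
                    (∀ i → toℕ i < l → f i ≡ 1ℚ) → sumℚ f ≡ 0ℚ → l ℕ.+ l ≤ n
ternary-sum-bound {n} {l} f l≤n ternary one-below sum-zero =
  ℕtoℚ-cancel-≤ (ℚ.≤-trans (ℚ.≤-reflexive (ℕtoℚ-+ l l)) 2l≤n)
  where
  open ℚ.≤-Reasoning
  lower : Fin n → ℚ
  lower i = 𝟙[< l ] i + 𝟙[< l ] i - 1ℚ
  lower≤f : ∀ i → lower i ℚ.≤ f i
  lower≤f i with toℕ i <? l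
  ... | yes i<l rewrite 𝟙[<]-in i i<l = ℚ.≤-reflexive (sym (one-below i i<l))
  ... | no  i≮l rewrite 𝟙[<]-out i (ℕ.≮⇒≥ i≮l) = ternary⇒≥-1 (ternary i)
  sum-lower : sumℚ lower ≡ (ℕtoℚ l + ℕtoℚ l) - ℕtoℚ n
  sum-lower = begin-equality
    sumℚ lower
      ≡⟨ sumℚ-distrib-minus {n} (λ i → 𝟙[< l ] i + 𝟙[< l ] i) (λ _ → 1ℚ) ⟩
    sumℚ {n} (λ i → 𝟙[< l ] i + 𝟙[< l ] i) - sumℚ {n} (λ _ → 1ℚ)
      ≡⟨ cong₂ _-_ (sumℚ-distrib-+ {n} 𝟙[< l ] 𝟙[< l ]) (trans (sumℚ-const n 1ℚ) (ℚ.*-identityʳ (ℕtoℚ n))) ⟩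
    (sumℚ {n} 𝟙[< l ] + sumℚ {n} 𝟙[< l ]) - ℕtoℚ n
      ≡⟨ cong (λ s → (s + s) - ℕtoℚ n) (sumℚ-𝟙[<] n l l≤n) ⟩
    (ℕtoℚ l + ℕtoℚ l) - ℕtoℚ n
      ∎
  2l≤n : ℕtoℚ l + ℕtoℚ l ℚ.≤ ℕtoℚ n
  2l≤n = begin
    ℕtoℚ l + ℕtoℚ l                       ≡⟨ sym (u-s+s≡u (ℕtoℚ l + ℕtoℚ l) (ℕtoℚ n)) ⟩
    ((ℕtoℚ l + ℕtoℚ l) - ℕtoℚ n) + ℕtoℚ n  ≡⟨ cong (_+ ℕtoℚ n) (sym sum-lower) ⟩
    sumℚ lower + ℕtoℚ n                    ≤⟨ ℚ.+-monoˡ-≤ (ℕtoℚ n) (sumℚ-mono-≤ lower≤f) ⟩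
    sumℚ f + ℕtoℚ n                        ≡⟨ cong (_+ ℕtoℚ n) sum-zero ⟩
    0ℚ + ℕtoℚ n                            ≡⟨ ℚ.+-identityˡ (ℕtoℚ n) ⟩
    ℕtoℚ n                                 ∎

-- coadjℚ b i i = 1, but the diagonal term of complementLaplacian vanishes, so that
-- complementLaplacian b x is L(Ḡ) x.
coadjℚ : (Fin n → Bool) → Fin n → Fin n → ℚ
coadjℚ b i j = 1ℚ - adjℚ b i j

complementLaplacian : (Fin n → Bool) → (Fin n → ℚ) → Fin n → ℚ
complementLaplacian b x i = sumℚ (λ j → coadjℚ b i j * (x i - x j))

laplacian-row : (b : Fin n → Bool) (x : Fin n → ℚ) (i : Fin n) →
                mulVec (laplacian b) x i ≡ sumℚ (λ j → adjℚ b i j * (x i - x j))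
laplacian-row b x i = begin
  sumℚ (λ j → (δ j - adjℚ b i j) * x j)
    ≡⟨ sumℚ-cong (λ j → ℚ-ring.[y-z]x≈yx-zx (x j) (δ j) (adjℚ b i j)) ⟩
  sumℚ (λ j → δ j * x j - adjℚ b i j * x j)
    ≡⟨ sumℚ-distrib-minus (λ j → δ j * x j) (λ j → adjℚ b i j * x j) ⟩
  sumℚ (λ j → δ j * x j) - sumℚ (λ j → adjℚ b i j * x j)
    ≡⟨ cong (_- sumℚ (λ j → adjℚ b i j * x j)) diagonal ⟩
  degree b i * x i - sumℚ (λ j → adjℚ b i j * x j)
    ≡⟨ cong (_- sumℚ (λ j → adjℚ b i j * x j)) (*-distribʳ-sumℚ (x i) (adjℚ b i)) ⟩
  sumℚ (λ j → adjℚ b i j * x i) - sumℚ (λ j → adjℚ b i j * x j)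
    ≡⟨ sym (sumℚ-distrib-minus (λ j → adjℚ b i j * x i) (λ j → adjℚ b i j * x j)) ⟩
  sumℚ (λ j → adjℚ b i j * x i - adjℚ b i j * x j)
    ≡⟨ sumℚ-cong (λ j → sym (ℚ-ring.x[y-z]≈xy-xz (adjℚ b i j) (x i) (x j))) ⟩
  sumℚ (λ j → adjℚ b i j * (x i - x j))  ∎
  where
  open ≡-Reasoning
  δ : Fin _ → ℚ
  δ j = if ⌊ i Fin.≟ j ⌋ then degree b i else 0ℚ
  δ-off : ∀ j → j ≢ i → δ j * x j ≡ 0ℚ
  δ-off j j≢i rewrite isYes≗does (i Fin.≟ j) | dec-false (i Fin.≟ j) (j≢i ∘ sym) = ℚ.*-zeroˡ (x j)
  diagonal : sumℚ (λ j → δ j * x j) ≡ degree b i * x i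
  diagonal rewrite sumℚ-supported i (λ j → δ j * x j) δ-off
                 | isYes≗does (i Fin.≟ i) | dec-true (i Fin.≟ i) refl = refl

laplacian+complement : (b : Fin n → Bool) (x : Fin n → ℚ) (i : Fin n) →
  mulVec (laplacian b) x i + (sumℚ x + complementLaplacian b x i) ≡ ℕtoℚ n * x i
laplacian+complement {n} b x i = begin
  mulVec (laplacian b) x i + (sumℚ x + complementLaplacian b x i)
    ≡⟨ cong (_+ (sumℚ x + complementLaplacian b x i)) (laplacian-row b x i) ⟩
  sumℚ (λ j → adjℚ b i j * z j) + (sumℚ x + sumℚ (λ j → coadjℚ b i j * z j))
    ≡⟨ regroup (sumℚ (λ j → adjℚ b i j * z j)) (sumℚ x) (sumℚ (λ j → coadjℚ b i j * z j)) ⟩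
  (sumℚ (λ j → adjℚ b i j * z j) + sumℚ (λ j → coadjℚ b i j * z j)) + sumℚ x
    ≡⟨ cong (_+ sumℚ x) (sym (sumℚ-distrib-+ (λ j → adjℚ b i j * z j) (λ j → coadjℚ b i j * z j))) ⟩
  sumℚ (λ j → adjℚ b i j * z j + coadjℚ b i j * z j) + sumℚ x
    ≡⟨ cong (_+ sumℚ x) (sumℚ-cong (λ j → split (adjℚ b i j) (z j))) ⟩
  sumℚ z + sumℚ x
    ≡⟨ cong (_+ sumℚ x) (sumℚ-distrib-minus (λ _ → x i) x) ⟩
  (sumℚ {n} (λ _ → x i) - sumℚ x) + sumℚ x
    ≡⟨ cong (λ s → (s - sumℚ x) + sumℚ x) (sumℚ-const n (x i)) ⟩
  (ℕtoℚ n * x i - sumℚ x) + sumℚ x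
    ≡⟨ u-s+s≡u (ℕtoℚ n * x i) (sumℚ x) ⟩
  ℕtoℚ n * x i  ∎
  where
  open ≡-Reasoning
  z : Fin n → ℚ
  z j = x i - x j
  regroup : ∀ u s t → u + (s + t) ≡ (u + t) + s
  regroup = solve-∀ ℚ-solverRing
  split : ∀ a y → a * y + (1ℚ - a) * y ≡ y
  split = solve-∀ ℚ-solverRing

eigenvalue-n⇔ : (b : Fin n → Bool) (x : Fin n → ℚ) →
  InEigenspace (laplacian b) (ℕtoℚ n) x ⇔ (∀ i → sumℚ x + complementLaplacian b x i ≡ 0ℚ)
eigenvalue-n⇔ {n} b x = mk⇔
  (λ eigen i → ℚ-ring.+-identityʳ-unique _ _ (trans (laplacian+complement b x i) (sym (eigen i))))
  (λ vanishes i → begin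
    mulVec (laplacian b) x i
      ≡⟨ sym (ℚ.+-identityʳ _) ⟩
    mulVec (laplacian b) x i + 0ℚ
      ≡⟨ cong (mulVec (laplacian b) x i +_) (sym (vanishes i)) ⟩
    mulVec (laplacian b) x i + (sumℚ x + complementLaplacian b x i)
      ≡⟨ laplacian+complement b x i ⟩
    ℕtoℚ n * x i  ∎)
  where open ≡-Reasoning

complementLaplacian-zero : (b : Fin n → Bool) (x : Fin n → ℚ) (i : Fin n) →
  (∀ j → coadjℚ b i j ≡ 0ℚ ⊎ x i ≡ x j) → complementLaplacian b x i ≡ 0ℚ
complementLaplacian-zero b x i h = sumℚ-zero _ term-zero
  where
  term-zero : ∀ j → coadjℚ b i j * (x i - x j) ≡ 0ℚ
  term-zero j with h j
  ... | inj₁ coadj≡0 rewrite coadj≡0 = ℚ.*-zeroˡ (x i - x j)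
  ... | inj₂ xi≡xj rewrite xi≡xj =
    trans (cong (coadjℚ b i j *_) (ℚ.+-inverseʳ (x j))) (ℚ.*-zeroʳ (coadjℚ b i j))

adj-< : (b : Fin n → Bool) (i j : Fin n) → toℕ i < toℕ j → adj b i j ≡ b j
adj-< b i j i<j rewrite <ᵇ-true i<j | <ᵇ-false (ℕ.<⇒≤ i<j) = ∨-identityʳ (b j)

adj-> : (b : Fin n → Bool) (i j : Fin n) → toℕ j < toℕ i → adj b i j ≡ b i
adj-> b i j j<i rewrite <ᵇ-false (ℕ.<⇒≤ j<i) | <ᵇ-true j<i = refl

coadj-adjacent : (b : Fin n → Bool) (i j : Fin n) → adj b i j ≡ true → coadjℚ b i j ≡ 0ℚ
coadj-adjacent b i j adjacent = cong (λ c → 1ℚ - (if c then 1ℚ else 0ℚ)) adjacent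

coadj-nonadjacent : (b : Fin n → Bool) (i j : Fin n) → adj b i j ≡ false → coadjℚ b i j ≡ 1ℚ
coadj-nonadjacent b i j nonadjacent = cong (λ c → 1ℚ - (if c then 1ℚ else 0ℚ)) nonadjacent

coadj-nonneg : (b : Fin n → Bool) (i j : Fin n) → 0ℚ ℚ.≤ coadjℚ b i j
coadj-nonneg b i j with adj b i j
... | true  = ℚ.≤-refl
... | false = ℚ.nonNegative⁻¹ 1ℚ

maximum-on : {P : Pred (Fin n) 0ℓ} → Decidable P → (f : Fin n → ℚ) → ∀ {i₀} → P i₀ →
             Σ[ q ∈ Fin n ] P q × (∀ j → P j → f j ℚ.≤ f q)
maximum-on {n} P? f {i₀} Pi₀ =
  q , argmax-all f Pi₀ (all-filter P? (allFin n)) ,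
  λ j Pj → All.lookup (f[xs]≤f[argmax] i₀ candidates) (∈-filter⁺ P? (∈-allFin j) Pj)
  where
  candidates : List (Fin n)
  candidates = filter P? (allFin n)
  q : Fin n
  q = argmax f i₀ candidates

linComb-sum-zero : (c : Fin k → ℚ) (v : Fin k → Fin n → ℚ) →
                   (∀ t → sumℚ (v t) ≡ 0ℚ) → sumℚ (linComb c v) ≡ 0ℚ
linComb-sum-zero c v sums-zero = begin
  sumℚ (λ i → sumℚ (λ t → c t * v t i))   ≡⟨ sumℚ-comm (λ i t → c t * v t i) ⟩
  sumℚ (λ t → sumℚ (λ i → c t * v t i))   ≡⟨ sumℚ-cong (λ t → sym (*-distribˡ-sumℚ (c t) (v t))) ⟩
  sumℚ (λ t → c t * sumℚ (v t))           ≡⟨ sumℚ-zero _ (λ t → trans (cong (c t *_) (sums-zero t)) (ℚ.*-zeroʳ (c t))) ⟩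
  0ℚ                                      ∎
  where open ≡-Reasoning

module Threshold {n : ℕ} (b : Fin n → Bool) {l₁ : ℕ} (l₁<n : l₁ < n)
  (p : Fin n) (p+1≡l₁ : suc (toℕ p) ≡ l₁)
  (dominating : ∀ i → l₁ ≤ toℕ i → b i ≡ true) (b-p : b p ≡ false) where

  Eigenvector : (Fin n → ℚ) → Set
  Eigenvector = InEigenspace (laplacian b) (ℕtoℚ n)

  ConstantOnBlock : (Fin n → ℚ) → Set
  ConstantOnBlock x = ∀ j → toℕ j < l₁ → x j ≡ x p

  p<l₁ : toℕ p < l₁
  p<l₁ = ℕ.≤-reflexive p+1≡l₁

  below-p : ∀ {j} → toℕ j < l₁ → j ≢ p → toℕ j < toℕ p
  below-p j<l₁ j≢p = ℕ.≤∧≢⇒< (ℕ.≤-pred (ℕ.≤-trans j<l₁ (ℕ.≤-reflexive (sym p+1≡l₁))))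
                              (j≢p ∘ Fin.toℕ-injective)

  coadj-dominating : ∀ {i j} → i ≢ j → l₁ ≤ toℕ i ⊎ l₁ ≤ toℕ j → coadjℚ b i j ≡ 0ℚ
  coadj-dominating {i} {j} i≢j i-or-j-dominating with ℕ.<-cmp (toℕ i) (toℕ j)
  ... | tri< i<j _ _ = coadj-adjacent b i j (trans (adj-< b i j i<j) (dominating j j-dominating))
    where
    j-dominating : l₁ ≤ toℕ j
    j-dominating = [ (λ l₁≤i → ℕ.≤-trans l₁≤i (ℕ.<⇒≤ i<j)) , (λ l₁≤j → l₁≤j) ] i-or-j-dominating
  ... | tri≈ _ i≡j _ = contradiction (Fin.toℕ-injective i≡j) i≢j
  ... | tri> _ _ j<i = coadj-adjacent b i j (trans (adj-> b i j j<i) (dominating i i-dominating))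
    where
    i-dominating : l₁ ≤ toℕ i
    i-dominating = [ (λ l₁≤i → l₁≤i) , (λ l₁≤j → ℕ.≤-trans l₁≤j (ℕ.<⇒≤ j<i)) ] i-or-j-dominating

  coadj-p : ∀ j → toℕ j < toℕ p → coadjℚ b p j ≡ 1ℚ
  coadj-p j j<p = coadj-nonadjacent b p j (trans (adj-> b p j j<p) b-p)

  coadj-to-p : ∀ j → toℕ j < toℕ p → coadjℚ b j p ≡ 1ℚ
  coadj-to-p j j<p = coadj-nonadjacent b j p (trans (adj-< b j p j<p) b-p)

  d : Fin n
  d = Fin.fromℕ< l₁<n

  l₁≤d : l₁ ≤ toℕ d
  l₁≤d = ℕ.≤-reflexive (sym (Fin.toℕ-fromℕ< l₁<n))

  complementLaplacian-dominating : ∀ x i → l₁ ≤ toℕ i → complementLaplacian b x i ≡ 0ℚ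
  complementLaplacian-dominating x i l₁≤i = complementLaplacian-zero b x i term
    where
    term : ∀ j → coadjℚ b i j ≡ 0ℚ ⊎ x i ≡ x j
    term j with i Fin.≟ j
    ... | yes i≡j = inj₂ (cong x i≡j)
    ... | no  i≢j = inj₁ (coadj-dominating i≢j (inj₁ l₁≤i))

  constantOnBlock⇒complementLaplacian-zero : ∀ {x} → ConstantOnBlock x → ∀ i → complementLaplacian b x i ≡ 0ℚ
  constantOnBlock⇒complementLaplacian-zero {x} constant i = complementLaplacian-zero b x i term
    where
    term : ∀ j → coadjℚ b i j ≡ 0ℚ ⊎ x i ≡ x j
    term j with i Fin.≟ j | l₁ ℕ.≤? toℕ i | l₁ ℕ.≤? toℕ j
    ... | yes i≡j | _         | _         = inj₂ (cong x i≡j)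
    ... | no  i≢j | yes l₁≤i  | _         = inj₁ (coadj-dominating i≢j (inj₁ l₁≤i))
    ... | no  i≢j | no  _     | yes l₁≤j  = inj₁ (coadj-dominating i≢j (inj₂ l₁≤j))
    ... | no  _   | no  l₁≰i  | no  l₁≰j  = inj₂ (trans (constant i (ℕ.≰⇒> l₁≰i)) (sym (constant j (ℕ.≰⇒> l₁≰j))))

  eigenvector⇒sum-zero : ∀ {x} → Eigenvector x → sumℚ x ≡ 0ℚ
  eigenvector⇒sum-zero {x} eigen = begin
    sumℚ x                              ≡⟨ sym (ℚ.+-identityʳ (sumℚ x)) ⟩
    sumℚ x + 0ℚ                         ≡⟨ cong (sumℚ x +_) (sym (complementLaplacian-dominating x d l₁≤d)) ⟩
    sumℚ x + complementLaplacian b x d  ≡⟨ Equivalence.to (eigenvalue-n⇔ b x) eigen d ⟩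
    0ℚ                                  ∎
    where open ≡-Reasoning

  eigenvector⇒complementLaplacian-zero : ∀ {x} → Eigenvector x → ∀ i → complementLaplacian b x i ≡ 0ℚ
  eigenvector⇒complementLaplacian-zero {x} eigen i = begin
    complementLaplacian b x i           ≡⟨ sym (ℚ.+-identityˡ _) ⟩
    0ℚ + complementLaplacian b x i      ≡⟨ cong (_+ complementLaplacian b x i) (sym (eigenvector⇒sum-zero eigen)) ⟩
    sumℚ x + complementLaplacian b x i  ≡⟨ Equivalence.to (eigenvalue-n⇔ b x) eigen i ⟩
    0ℚ                                  ∎
    where open ≡-Reasoning

  maximum-spreads : ∀ x q → complementLaplacian b x q ≡ 0ℚ → toℕ q < l₁ →
                    (∀ j → toℕ j < l₁ → x j ℚ.≤ x q) →
                    ∀ j → coadjℚ b q j ≡ 1ℚ → x j ≡ x q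
  maximum-spreads x q balanced q<l₁ maximal j coadj≡1 =
    sym (ℚ-ring.x∙y⁻¹≈ε⇒x≈y (x q) (x j) (begin
      x q - x j                    ≡⟨ sym (ℚ.*-identityˡ (x q - x j)) ⟩
      1ℚ * (x q - x j)             ≡⟨ cong (_* (x q - x j)) (sym coadj≡1) ⟩
      coadjℚ b q j * (x q - x j)   ≡⟨ nonneg-sumℚ-zero term-nonneg balanced j ⟩
      0ℚ                           ∎))
    where
    open ≡-Reasoning
    term-nonneg : ∀ k → 0ℚ ℚ.≤ coadjℚ b q k * (x q - x k)
    term-nonneg k with l₁ ℕ.≤? toℕ k
    ... | yes l₁≤k = ℚ.≤-reflexive (sym (trans (cong (_* (x q - x k)) (coadj-dominating q≢k (inj₂ l₁≤k)))
                                                (ℚ.*-zeroˡ (x q - x k))))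
      where
      q≢k : q ≢ k
      q≢k q≡k = ℕ.<⇒≱ q<l₁ (subst (λ i → l₁ ≤ toℕ i) (sym q≡k) l₁≤k)
    ... | no  l₁≰k = *-nonneg (coadj-nonneg b q k) (≤⇒0≤- (maximal k (ℕ.≰⇒> l₁≰k)))

  p-maximal : ∀ {x} → Eigenvector x → ∀ j → toℕ j < l₁ → x j ℚ.≤ x p
  p-maximal {x} eigen with maximum-on (λ i → toℕ i <? l₁) x p<l₁
  ... | q , q<l₁ , q-maximal with q Fin.≟ p
  ...   | yes refl = q-maximal
  ...   | no  q≢p  = λ j j<l₁ → subst (x j ℚ.≤_) (sym xp≡xq) (q-maximal j j<l₁)
    where
    xp≡xq : x p ≡ x q
    xp≡xq = maximum-spreads x q (eigenvector⇒complementLaplacian-zero eigen q) q<l₁ q-maximal p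
                            (coadj-to-p q (below-p q<l₁ q≢p))

  eigenvector⇒constantOnBlock : ∀ {x} → Eigenvector x → ConstantOnBlock x
  eigenvector⇒constantOnBlock {x} eigen j j<l₁ with j Fin.≟ p
  ... | yes j≡p = cong x j≡p
  ... | no  j≢p = maximum-spreads x p (eigenvector⇒complementLaplacian-zero eigen p) p<l₁
                                  (p-maximal eigen) j (coadj-p j (below-p j<l₁ j≢p))

  eigenspace⇔ : ∀ {x} → Eigenvector x ⇔ (sumℚ x ≡ 0ℚ × ConstantOnBlock x)
  eigenspace⇔ {x} = mk⇔
    (λ eigen → eigenvector⇒sum-zero eigen , eigenvector⇒constantOnBlock eigen)
    (λ (sum-zero , constant) → Equivalence.from (eigenvalue-n⇔ b x)
       (λ i → cong₂ _+_ sum-zero (constantOnBlock⇒complementLaplacian-zero constant i)))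

  m : ℕ
  m = n ∸ suc l₁

  dominatingVertex-bound : ∀ (s : Fin m) → l₁ ℕ.+ suc (toℕ s) < n
  dominatingVertex-bound s = begin-strict
    l₁ ℕ.+ suc (toℕ s)   ≡⟨ ℕ.+-suc l₁ (toℕ s) ⟩
    suc l₁ ℕ.+ toℕ s     <⟨ ℕ.+-monoʳ-< (suc l₁) (Fin.toℕ<n s) ⟩
    suc l₁ ℕ.+ m         ≡⟨ ℕ.m+[n∸m]≡n l₁<n ⟩
    n                    ∎
    where open ℕ.≤-Reasoning

  dominatingVertex : Fin m → Fin n
  dominatingVertex s = Fin.fromℕ< (dominatingVertex-bound s)

  toℕ-dominatingVertex : ∀ s → toℕ (dominatingVertex s) ≡ l₁ ℕ.+ suc (toℕ s)
  toℕ-dominatingVertex s = Fin.toℕ-fromℕ< _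

  vertex-cases : ∀ i → i ≢ d → toℕ i < l₁ ⊎ Σ[ s ∈ Fin m ] i ≡ dominatingVertex s
  vertex-cases i i≢d with toℕ i <? l₁
  ... | yes i<l₁ = inj₁ i<l₁
  ... | no  i≮l₁ = inj₂ (s , Fin.toℕ-injective (trans (sym l₁+1+s≡i) (sym (toℕ-dominatingVertex s))))
    where
    l₁<i : l₁ < toℕ i
    l₁<i = ℕ.≤∧≢⇒< (ℕ.≮⇒≥ i≮l₁) (λ l₁≡i → i≢d (Fin.toℕ-injective (trans (sym l₁≡i) (sym (Fin.toℕ-fromℕ< l₁<n)))))
    s : Fin m
    s = Fin.fromℕ< (ℕ.∸-monoˡ-< (Fin.toℕ<n i) l₁<i)
    l₁+1+s≡i : l₁ ℕ.+ suc (toℕ s) ≡ toℕ i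
    l₁+1+s≡i = begin
      l₁ ℕ.+ suc (toℕ s)              ≡⟨ cong (λ t → l₁ ℕ.+ suc t) (Fin.toℕ-fromℕ< _) ⟩
      l₁ ℕ.+ suc (toℕ i ∸ suc l₁)     ≡⟨ ℕ.+-suc l₁ _ ⟩
      suc l₁ ℕ.+ (toℕ i ∸ suc l₁)     ≡⟨ ℕ.m+[n∸m]≡n l₁<i ⟩
      toℕ i                           ∎
      where open ≡-Reasoning

  blockVector : Fin n → ℚ
  blockVector i = 𝟙[< l₁ ] i + 𝟙[< l₁ ] i - 𝟙[< l₁ ℕ.+ l₁ ] i

  basis : Fin (suc m) → Fin n → ℚ
  basis zero    = blockVector
  basis (suc s) = λ i → 𝟙[≡ l₁ ℕ.+ suc (toℕ s) ] i - 𝟙[≡ l₁ ] i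

  blockVector-on-block : ∀ j → toℕ j < l₁ → blockVector j ≡ 1ℚ
  blockVector-on-block j j<l₁
    rewrite 𝟙[<]-in j j<l₁ | 𝟙[<]-in j (ℕ.<-≤-trans j<l₁ (ℕ.m≤m+n l₁ l₁)) = refl

  basis-on-block : ∀ s j → toℕ j < l₁ → basis (suc s) j ≡ 0ℚ
  basis-on-block s j j<l₁
    rewrite 𝟙[≡]-off j (ℕ.<⇒≢ (ℕ.<-≤-trans j<l₁ (ℕ.m≤m+n l₁ (suc (toℕ s)))))
          | 𝟙[≡]-off j (ℕ.<⇒≢ j<l₁) = refl

  basis-ternary : ∀ t i → IsTernary (basis t i)
  basis-ternary zero    i with toℕ i <? l₁
  ... | yes i<l₁ rewrite blockVector-on-block i i<l₁ = inj₂ (inj₂ refl)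
  ... | no  i≮l₁ rewrite 𝟙[<]-out i (ℕ.≮⇒≥ i≮l₁) with toℕ i <ᵇ l₁ ℕ.+ l₁
  ...   | true  = inj₁ refl
  ...   | false = inj₂ (inj₁ refl)
  basis-ternary (suc s) i = ternary-0/1-difference (toℕ i ≡ᵇ l₁ ℕ.+ suc (toℕ s)) (toℕ i ≡ᵇ l₁)

  basis-constantOnBlock : ∀ t → ConstantOnBlock (basis t)
  basis-constantOnBlock zero    j j<l₁ = trans (blockVector-on-block j j<l₁) (sym (blockVector-on-block p p<l₁))
  basis-constantOnBlock (suc s) j j<l₁ = trans (basis-on-block s j j<l₁) (sym (basis-on-block s p p<l₁))

  basis-at-own-vertex : ∀ s → basis (suc s) (dominatingVertex s) ≡ 1ℚ
  basis-at-own-vertex s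
    rewrite 𝟙[≡]-at (dominatingVertex s) (toℕ-dominatingVertex s)
          | 𝟙[≡]-off (dominatingVertex s) (ℕ.m+1+n≢m l₁ ∘ trans (sym (toℕ-dominatingVertex s))) = refl

  offset-injective : ∀ {s s′ : Fin m} → l₁ ℕ.+ suc (toℕ s) ≡ l₁ ℕ.+ suc (toℕ s′) → s ≡ s′
  offset-injective eq = Fin.toℕ-injective (ℕ.suc-injective (ℕ.+-cancelˡ-≡ l₁ _ _ eq))

  basis-at-other-vertex : ∀ s s′ → s′ ≢ s → basis (suc s′) (dominatingVertex s) ≡ 0ℚ
  basis-at-other-vertex s s′ s′≢s
    rewrite 𝟙[≡]-off (dominatingVertex s) (s′≢s ∘ sym ∘ offset-injective ∘ trans (sym (toℕ-dominatingVertex s)))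
          | 𝟙[≡]-off (dominatingVertex s) (ℕ.m+1+n≢m l₁ ∘ trans (sym (toℕ-dominatingVertex s))) = refl

  linComb-on-block : ∀ c j → toℕ j < l₁ → linComb c basis j ≡ c zero
  linComb-on-block c j j<l₁ = begin
    c zero * blockVector j + sumℚ (λ s → c (suc s) * basis (suc s) j)
      ≡⟨ cong₂ _+_ (cong (c zero *_) (blockVector-on-block j j<l₁)) (sumℚ-zero _ rest-zero) ⟩
    c zero * 1ℚ + 0ℚ
      ≡⟨ trans (ℚ.+-identityʳ _) (ℚ.*-identityʳ (c zero)) ⟩
    c zero  ∎
    where
    open ≡-Reasoning
    rest-zero : ∀ s → c (suc s) * basis (suc s) j ≡ 0ℚ
    rest-zero s = trans (cong (c (suc s) *_) (basis-on-block s j j<l₁)) (ℚ.*-zeroʳ (c (suc s)))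

  linComb-at-dominating : ∀ c s → linComb c basis (dominatingVertex s) ≡
                                  c zero * blockVector (dominatingVertex s) + c (suc s)
  linComb-at-dominating c s = cong (c zero * blockVector v +_) (begin
    sumℚ (λ s′ → c (suc s′) * basis (suc s′) v)  ≡⟨ sumℚ-supported s _ others-zero ⟩
    c (suc s) * basis (suc s) v                  ≡⟨ cong (c (suc s) *_) (basis-at-own-vertex s) ⟩
    c (suc s) * 1ℚ                               ≡⟨ ℚ.*-identityʳ (c (suc s)) ⟩
    c (suc s)                                    ∎)
    where
    open ≡-Reasoning
    v : Fin n
    v = dominatingVertex s
    others-zero : ∀ s′ → s′ ≢ s → c (suc s′) * basis (suc s′) v ≡ 0ℚ
    others-zero s′ s′≢s = trans (cong (c (suc s′) *_) (basis-at-other-vertex s s′ s′≢s)) (ℚ.*-zeroʳ (c (suc s′)))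

  basis-independent : LinearlyIndependent basis
  basis-independent c lc≡0 zero    = trans (sym (linComb-on-block c p p<l₁)) (lc≡0 p)
  basis-independent c lc≡0 (suc s) = begin
    c (suc s)                            ≡⟨ sym (ℚ.+-identityˡ (c (suc s))) ⟩
    0ℚ + c (suc s)                       ≡⟨ cong (_+ c (suc s)) (sym (ℚ.*-zeroˡ (blockVector v))) ⟩
    0ℚ * blockVector v + c (suc s)       ≡⟨ cong (λ a → a * blockVector v + c (suc s)) (sym (basis-independent c lc≡0 zero)) ⟩
    c zero * blockVector v + c (suc s)   ≡⟨ sym (linComb-at-dominating c s) ⟩
    linComb c basis v                    ≡⟨ lc≡0 v ⟩
    0ℚ                                   ∎
    where
    open ≡-Reasoning
    v : Fin n
    v = dominatingVertex s

  module _ (l₁+l₁≤n : l₁ ℕ.+ l₁ ≤ n) where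

    basis-sum-zero : ∀ t → sumℚ (basis t) ≡ 0ℚ
    basis-sum-zero zero = begin
      sumℚ blockVector
        ≡⟨ sumℚ-distrib-minus {n} (λ i → 𝟙[< l₁ ] i + 𝟙[< l₁ ] i) 𝟙[< l₁ ℕ.+ l₁ ] ⟩
      sumℚ {n} (λ i → 𝟙[< l₁ ] i + 𝟙[< l₁ ] i) - sumℚ {n} 𝟙[< l₁ ℕ.+ l₁ ]
        ≡⟨ cong₂ _-_ (sumℚ-distrib-+ {n} 𝟙[< l₁ ] 𝟙[< l₁ ]) (sumℚ-𝟙[<] n (l₁ ℕ.+ l₁) l₁+l₁≤n) ⟩
      (sumℚ {n} 𝟙[< l₁ ] + sumℚ {n} 𝟙[< l₁ ]) - ℕtoℚ (l₁ ℕ.+ l₁)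
        ≡⟨ cong₂ (λ a c → (a + a) - c) (sumℚ-𝟙[<] n l₁ (ℕ.<⇒≤ l₁<n)) (ℕtoℚ-+ l₁ l₁) ⟩
      (ℕtoℚ l₁ + ℕtoℚ l₁) - (ℕtoℚ l₁ + ℕtoℚ l₁)
        ≡⟨ ℚ.+-inverseʳ (ℕtoℚ l₁ + ℕtoℚ l₁) ⟩
      0ℚ  ∎
      where open ≡-Reasoning
    basis-sum-zero (suc s) = begin
      sumℚ (basis (suc s))
        ≡⟨ sumℚ-distrib-minus {n} 𝟙[≡ l₁ ℕ.+ suc (toℕ s) ] 𝟙[≡ l₁ ] ⟩
      sumℚ {n} 𝟙[≡ l₁ ℕ.+ suc (toℕ s) ] - sumℚ {n} 𝟙[≡ l₁ ]
        ≡⟨ cong₂ _-_ (sumℚ-𝟙[≡] n _ (dominatingVertex-bound s)) (sumℚ-𝟙[≡] n l₁ l₁<n) ⟩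
      1ℚ - 1ℚ
        ≡⟨⟩
      0ℚ
        ∎
      where open ≡-Reasoning

    basis-eigenvector : ∀ t → Eigenvector (basis t)
    basis-eigenvector t = Equivalence.from eigenspace⇔ (basis-sum-zero t , basis-constantOnBlock t)

    basis-spans : ∀ x → Eigenvector x → Σ[ c ∈ (Fin (suc m) → ℚ) ] ∀ i → x i ≡ linComb c basis i
    basis-spans x eigen = c , λ i → ℚ-ring.x∙y⁻¹≈ε⇒x≈y _ _ (residual-zero i)
      where
      open ≡-Reasoning
      sum-zero : sumℚ x ≡ 0ℚ
      sum-zero = proj₁ (Equivalence.to eigenspace⇔ eigen)
      constant : ConstantOnBlock x
      constant = proj₂ (Equivalence.to eigenspace⇔ eigen)
      c : Fin (suc m) → ℚ
      c zero    = x p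
      c (suc s) = x (dominatingVertex s) - x p * blockVector (dominatingVertex s)
      residual : Fin n → ℚ
      residual i = x i - linComb c basis i
      u-[a+[u-a]]≡0 : ∀ u a → u - (a + (u - a)) ≡ 0ℚ
      u-[a+[u-a]]≡0 = solve-∀ ℚ-solverRing
      residual-off-d : ∀ i → i ≢ d → residual i ≡ 0ℚ
      residual-off-d i i≢d with vertex-cases i i≢d
      ... | inj₁ i<l₁ rewrite linComb-on-block c i i<l₁ | constant i i<l₁ = ℚ.+-inverseʳ (x p)
      ... | inj₂ (s , refl) rewrite linComb-at-dominating c s =
        u-[a+[u-a]]≡0 (x (dominatingVertex s)) (x p * blockVector (dominatingVertex s))
      residual-sum : sumℚ residual ≡ 0ℚ
      residual-sum = begin
        sumℚ residual                           ≡⟨ sumℚ-distrib-minus x (linComb c basis) ⟩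
        sumℚ x - sumℚ (linComb c basis)         ≡⟨ cong₂ _-_ sum-zero (linComb-sum-zero c basis basis-sum-zero) ⟩
        0ℚ - 0ℚ                                 ≡⟨⟩
        0ℚ                                      ∎
      residual-zero : ∀ i → residual i ≡ 0ℚ
      residual-zero i with i Fin.≟ d
      ... | yes refl = trans (sym (sumℚ-supported d residual residual-off-d)) residual-sum
      ... | no  i≢d  = residual-off-d i i≢d

    sufficiency : SimplyStructured (laplacian b) (ℕtoℚ n)
    sufficiency = suc m , basis , (basis-eigenvector , basis-independent , basis-spans) , basis-ternary

  witness : Fin n → ℚ
  witness i = 𝟙[< l₁ ] i - ℕtoℚ l₁ * 𝟙[≡ l₁ ] i

  witness-on-block : ∀ j → toℕ j < l₁ → witness j ≡ 1ℚ
  witness-on-block j j<l₁ rewrite 𝟙[<]-in j j<l₁ | 𝟙[≡]-off j (ℕ.<⇒≢ j<l₁) =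
    cong (λ a → 1ℚ - a) (ℚ.*-zeroʳ (ℕtoℚ l₁))

  witness-eigenvector : Eigenvector witness
  witness-eigenvector = Equivalence.from eigenspace⇔ (sum-zero , constant)
    where
    open ≡-Reasoning
    sum-zero : sumℚ witness ≡ 0ℚ
    sum-zero = begin
      sumℚ witness
        ≡⟨ sumℚ-distrib-minus {n} 𝟙[< l₁ ] (λ i → ℕtoℚ l₁ * 𝟙[≡ l₁ ] i) ⟩
      sumℚ {n} 𝟙[< l₁ ] - sumℚ {n} (λ i → ℕtoℚ l₁ * 𝟙[≡ l₁ ] i)
        ≡⟨ cong₂ _-_ (sumℚ-𝟙[<] n l₁ (ℕ.<⇒≤ l₁<n)) (sym (*-distribˡ-sumℚ {n} (ℕtoℚ l₁) 𝟙[≡ l₁ ])) ⟩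
      ℕtoℚ l₁ - ℕtoℚ l₁ * sumℚ {n} 𝟙[≡ l₁ ]
        ≡⟨ cong (λ s → ℕtoℚ l₁ - ℕtoℚ l₁ * s) (sumℚ-𝟙[≡] n l₁ l₁<n) ⟩
      ℕtoℚ l₁ - ℕtoℚ l₁ * 1ℚ
        ≡⟨ cong (λ a → ℕtoℚ l₁ - a) (ℚ.*-identityʳ (ℕtoℚ l₁)) ⟩
      ℕtoℚ l₁ - ℕtoℚ l₁
        ≡⟨ ℚ.+-inverseʳ (ℕtoℚ l₁) ⟩
      0ℚ  ∎
    constant : ConstantOnBlock witness
    constant j j<l₁ = trans (witness-on-block j j<l₁) (sym (witness-on-block p p<l₁))

  ternary-eigenvector-bound : ∀ {x} → Eigenvector x → (∀ i → IsTernary (x i)) → x p ≢ 0ℚ →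
                              l₁ ℕ.+ l₁ ≤ n
  ternary-eigenvector-bound {x} eigen ternary xp≢0 = bound (ternary p)
    where
    sum-zero : sumℚ x ≡ 0ℚ
    sum-zero = proj₁ (Equivalence.to eigenspace⇔ eigen)
    constant : ConstantOnBlock x
    constant = proj₂ (Equivalence.to eigenspace⇔ eigen)
    bound : IsTernary (x p) → l₁ ℕ.+ l₁ ≤ n
    bound (inj₁ xp≡-1) =
      ternary-sum-bound (λ i → - x i) (ℕ.<⇒≤ l₁<n) (ternary-neg ∘ ternary)
        (λ j j<l₁ → cong -_ (trans (constant j j<l₁) xp≡-1)) (trans (sumℚ-distrib-neg x) (cong -_ sum-zero))
    bound (inj₂ (inj₁ xp≡0)) = contradiction xp≡0 xp≢0
    bound (inj₂ (inj₂ xp≡1)) =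
      ternary-sum-bound x (ℕ.<⇒≤ l₁<n) ternary (λ j j<l₁ → trans (constant j j<l₁) xp≡1) sum-zero

  necessity : SimplyStructured (laplacian b) (ℕtoℚ n) → l₁ ℕ.+ l₁ ≤ n
  necessity (k , v , (eigen , _ , spans) , ternary) with l₁ ℕ.+ l₁ ℕ.≤? n
  ... | yes fits    = fits
  ... | no  too-big = contradiction 1≡0 ℚ.1≢0
    where
    open ≡-Reasoning
    vanishes-at-p : ∀ t → v t p ≡ 0ℚ
    vanishes-at-p t with v t p ℚ.≟ 0ℚ
    ... | yes vtp≡0 = vtp≡0
    ... | no  vtp≢0 = contradiction (ternary-eigenvector-bound (eigen t) (ternary t) vtp≢0) too-big
    c : Fin k → ℚ
    c = proj₁ (spans witness witness-eigenvector)
    1≡0 : 1ℚ ≡ 0ℚ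
    1≡0 = begin
      1ℚ             ≡⟨ sym (witness-on-block p p<l₁) ⟩
      witness p      ≡⟨ proj₂ (spans witness witness-eigenvector) p ⟩
      linComb c v p  ≡⟨ sumℚ-zero _ (λ t → trans (cong (c t *_) (vanishes-at-p t)) (ℚ.*-zeroʳ (c t))) ⟩
      0ℚ             ∎

m≤n/2⇔m+m≤n : ∀ {l} n → l ≤ n / 2 ⇔ l ℕ.+ l ≤ n
m≤n/2⇔m+m≤n {l} n = mk⇔
  (λ l≤n/2 → ℕ.≤-trans (ℕ.≤-reflexive (l+l≡l*2)) (ℕ.≤-trans (ℕ.*-monoˡ-≤ 2 l≤n/2) (m/n*n≤m n 2)))
  (λ l+l≤n → subst (_≤ n / 2) (m*n/n≡m l 2) (/-monoˡ-≤ 2 (subst (_≤ n) l+l≡l*2 l+l≤n)))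
  where
  l+l≡l*2 : l ℕ.+ l ≡ l ℕ.* 2
  l+l≡l*2 = trans (cong (l ℕ.+_) (sym (ℕ.+-identityʳ l))) (ℕ.*-comm 2 l)

proposition3p2 : (n : ℕ) (b : Fin n → Bool) (l₁ : ℕ) →
    (∀ i → toℕ i ≡ 0 → b i ≡ false) →
    (∀ i → suc (toℕ i) ≡ n → b i ≡ true) →
    1 ≤ l₁ → l₁ ≤ n ∸ 1 →
    (∀ i j → l₁ ≤ toℕ i → l₁ ≤ toℕ j → b i ≡ b j) →
    (∀ i j → suc (toℕ i) ≡ l₁ → toℕ j ≡ l₁ → b i ≢ b j) →
    SimplyStructured (laplacian b) (ℕtoℚ n) ⇔ (1 ≤ l₁ × l₁ ≤ n / 2)
proposition3p2 zero    b l₁      _ _      1≤l₁ l₁≤0 _ _ = contradiction (ℕ.≤-trans 1≤l₁ l₁≤0) λ ()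
proposition3p2 (suc n) b zero    _ _      ()   _    _ _
proposition3p2 (suc n) b (suc l) _ b-last 1≤l₁ l₁≤n b-const b-change =
  mk⇔ (λ simple → 1≤l₁ , Equivalence.from (m≤n/2⇔m+m≤n (suc n)) (necessity simple))
      (λ (_ , l₁≤n/2) → sufficiency (Equivalence.to (m≤n/2⇔m+m≤n (suc n)) l₁≤n/2))
  where
  l₁<n : suc l < suc n
  l₁<n = s≤s l₁≤n
  l<n : l < suc n
  l<n = ℕ.<-trans (ℕ.n<1+n l) l₁<n
  p d last : Fin (suc n)
  p = Fin.fromℕ< l<n
  d = Fin.fromℕ< l₁<n
  last = Fin.fromℕ n
  dominating : ∀ i → suc l ≤ toℕ i → b i ≡ true
  dominating i l₁≤i = trans (b-const i last l₁≤i (subst (suc l ≤_) (sym (Fin.toℕ-fromℕ n)) l₁≤n))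
                            (b-last last (cong suc (Fin.toℕ-fromℕ n)))
  b-p : b p ≡ false
  b-p = trans (¬-not (b-change p d (cong suc (Fin.toℕ-fromℕ< l<n)) (Fin.toℕ-fromℕ< l₁<n)))
              (cong not (dominating d (ℕ.≤-reflexive (sym (Fin.toℕ-fromℕ< l₁<n)))))
  open Threshold b l₁<n p (cong suc (Fin.toℕ-fromℕ< l<n)) dominating b-p
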